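{- Let $P$ be an $R$-labeled poset of rank $n$ with fixed $R$-labeling $\lambda$, let $\mathcal{M}$ be a maximal chain of $P$, and let $\{\hat 0=X_1<\dots<X_k=\hat 1\}$ be the decomposing chain of $\mathcal{M}$. Then \[ \omega\big(\mathsf{u}(\mathcal{M})\big)=\prod_{i=1}^{k-1}\omega\big(\mathsf{u}(\mathcal{M}_{[X_i,X_{i+1}]})\big). \]
   Context: A graded poset $P$ of rank $n$ is a finite poset with unique minimum $\hat 0$ (rank $0$) and unique maximum $\hat 1$ (rank $n$) such that ${\sf rank}(X)$ equals the length of every maximal chain from $\hat 0$ to $X$. An $R$-labeling is a map $\lambda$ from cover relations to positive integers such that every interval has a unique maximal chain with weakly increasing labels; $P$ is $R$-labeled if finite, graded and admitting one. Let $\mathbf{a},\mathbf{b}$ be noncommuting variables. For a maximal chain $\mathcal{M}=\{\mathcal{M}_0\lessdot\dots\lessdot\mathcal{M}_m\}$ of a graded poset of rank $m$ with labeling $\lambda$, $\mathsf{u}(\mathcal{M})=u_1\cdots u_m$ with $u_1=\mathbf{a}$ and, for $2\le i\le m$, $u_i=\mathbf{a}$ if $\lambda(\mathcal{M}_{i-2},\mathcal{M}_{i-1})\le\lambda(\mathcal{M}_{i-1},\mathcal{M}_i)$, else $\mathbf{b}$. Since $\mathsf{u}(\mathcal{M})$ begins with $\mathbf{a}$, it factors uniquely as a product of monomials $\mathbf{a}\mathbf{b}^{j_1}\cdots\mathbf{a}\mathbf{b}^{j_{k-1}}$ ($j_i\ge 0$); this induces a unique decomposition of $\mathcal{M}$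 into consecutive intervals $[X_i,X_{i+1}]$ (with $X_i\in\mathcal{M}$) such that the restriction $\mathcal{M}_{[X_i,X_{i+1}]}$ of $\mathcal{M}$ to $[X_i,X_{i+1}]$, viewed as a maximal chain of that interval with the restricted labeling, satisfies $\mathsf{u}(\mathcal{M}_{[X_i,X_{i+1}]})=\mathbf{a}\mathbf{b}^{j_i}$. The chain $\{\hat 0=X_1<\dots<X_k=\hat 1\}$ is the decomposing chain of $\mathcal{M}$. For a monomial in $\mathbf{a},\mathbf{b}$, $\omega$ replaces all occurrences of $\mathbf{a}\mathbf{b}$ with $\mathbf{a}\mathbf{b}+y\mathbf{b}\mathbf{a}+y\mathbf{a}\mathbf{b}+y^2\mathbf{b}\mathbf{a}$ and then simultaneously replaces all remaining $\mathbf{a}$ with $\mathbf{a}+y\mathbf{b}$ and all remaining $\mathbf{b}$ with $\mathbf{b}+y\mathbf{a}$. -}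

module Defs where

open import Data.Nat as ℕ using (ℕ; zero; suc; _+_)
open import Data.Fin using (Fin)
open import Data.List using (List; []; _∷_; _++_; map; concatMap; replicate; take; drop; length; foldr)
open import Data.List.Relation.Unary.Linked using (Linked)
open import Data.Product using (Σ; _×_; _,_; proj₁; proj₂)
open import Data.Empty using (⊥)
open import Data.Unit using (⊤)
open import Data.Bool using (if_then_else_)
open import Relation.Binary.Structures using (IsPartialOrder)
open import Relation.Binary.PropositionalEquality using (_≡_; _≢_)
open import Relation.Nullary.Decidable using (⌊_⌋)

data Letter : Set where
  𝐚 𝐛 : Letter

Word : Set
Word = List Letter

block : ℕ → Word
block j = 𝐚 ∷ replicate j 𝐛

-- Elements of ℕ[y]⟨a,b⟩, as finite formal sums (multisets) of terms
-- y^e · w, represented by lists of pairs (e , w).  Two such polynomials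
-- are equal iff their term lists are permutations of each other (_↭_).

Poly : Set
Poly = List (ℕ × Word)

one : Poly
one = (0 , []) ∷ []

_·_ : Poly → Poly → Poly
p · q = concatMap (λ t → map (λ s → (proj₁ t + proj₁ s , proj₂ t ++ proj₂ s)) q) p

prodP : List Poly → Poly
prodP = foldr _·_ one

-- ω on monomials: every occurrence of ab is replaced by
-- ab + y ba + y ab + y² ba, and the remaining a ↦ a + y b, b ↦ b + y a.
-- (Occurrences of ab never overlap, so a left-to-right scan finds them all.)
ω : Word → Poly
ω [] = one
ω (𝐚 ∷ 𝐛 ∷ w) =
  ((0 , 𝐚 ∷ 𝐛 ∷ []) ∷ (1 , 𝐛 ∷ 𝐚 ∷ []) ∷ (1 , 𝐚 ∷ 𝐛 ∷ []) ∷ (2 , 𝐛 ∷ 𝐚 ∷ []) ∷ []) · ω w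
ω (𝐚 ∷ w) = ((0 , 𝐚 ∷ []) ∷ (1 , 𝐛 ∷ []) ∷ []) · ω w
ω (𝐛 ∷ w) = ((0 , 𝐛 ∷ []) ∷ (1 , 𝐚 ∷ []) ∷ []) · ω w

uFrom : ℕ → List ℕ → Word
uFrom p [] = []
uFrom p (q ∷ qs) = (if ⌊ p ℕ.≤? q ⌋ then 𝐚 else 𝐛) ∷ uFrom q qs

uWord : List ℕ → Word
uWord [] = []
uWord (l ∷ ls) = 𝐚 ∷ uFrom l ls

record FinPoset : Set₁ where
  field
    size           : ℕ
    _≤_            : Fin size → Fin size → Set
    isPartialOrder : IsPartialOrder _≡_ _≤_

  Elt : Set
  Elt = Fin size

  _<_ : Elt → Elt → Set
  x < y = (x ≤ y) × (x ≢ y)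

  _⋖_ : Elt → Elt → Set
  x ⋖ y = (x < y) × (∀ z → x < z → z < y → ⊥)

  -- a chain M₀, M₁, …, M_m is represented as (M₀ , [M₁, …, M_m])
  Chain : Set
  Chain = Elt × List Elt

  CoverSeq : Elt → List Elt → Set
  CoverSeq x [] = ⊤
  CoverSeq x (y ∷ ys) = (x ⋖ y) × CoverSeq y ys

  lastFrom : Elt → List Elt → Elt
  lastFrom x [] = x
  lastFrom x (y ∷ ys) = lastFrom y ys

  lastOf : Chain → Elt
  lastOf (x , xs) = lastFrom x xs

  len : Chain → ℕ
  len (x , xs) = length xs

  IsMaxChain : Elt → Elt → Chain → Set
  IsMaxChain x y (c₀ , cs) = (c₀ ≡ x) × CoverSeq c₀ cs × (lastFrom c₀ cs ≡ y)

  -- labelings of cover relations (only values on covers matter)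
  Labeling : Set
  Labeling = Elt → Elt → ℕ

  labelsFrom : Labeling → Elt → List Elt → List ℕ
  labelsFrom lab x [] = []
  labelsFrom lab x (y ∷ ys) = lab x y ∷ labelsFrom lab y ys

  labels : Labeling → Chain → List ℕ
  labels lab (x , xs) = labelsFrom lab x xs

  u : Labeling → Chain → Word
  u lab c = uWord (labels lab c)

  IsRLabeling : Labeling → Set
  IsRLabeling lab = ∀ x y → x ≤ y →
    Σ Chain λ c → IsMaxChain x y c × Linked ℕ._≤_ (labels lab c) ×
      (∀ c′ → IsMaxChain x y c′ → Linked ℕ._≤_ (labels lab c′) → c′ ≡ c)

  -- splitting a chain into consecutive pieces with 1+j₁, 1+j₂, … covers:
  -- the restrictions M_[X_i , X_{i+1}] to the intervals of the chain
  -- X₁ < X₂ < … whose elements sit at positions 0, 1+j₁, 2+j₁+j₂, …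
  segments : List ℕ → Chain → List Chain
  segments [] c = []
  segments (j ∷ js) (x , xs) =
    (x , take (suc j) xs) ∷ segments js (lastFrom x (take (suc j) xs) , drop (suc j) xs)

record Graded (P : FinPoset) (n : ℕ) : Set where
  open FinPoset P
  field
    bot      : Elt
    top      : Elt
    bot-min  : ∀ x → bot ≤ x
    top-max  : ∀ x → x ≤ top
    rank     : Elt → ℕ
    rank-def : ∀ X c → IsMaxChain bot X c → len c ≡ rank X
    rank-top : rank top ≡ n

{-# OPTIONS --safe #-}
-- Since ω substitutes letter by letter except on the factors ab, it is multiplicative
-- across any cut placed just before an a: an occurrence of ab never straddles such a cut.
-- Every block a b^j begins with a, so ω(u(M)) is the product of the ω(a b^j). Restricting a
-- chain to an interval of its decomposing chain restricts its label sequence, and the word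
-- of a label sequence depends only on the comparisons between consecutive labels; hence the
-- restriction to the i-th interval has word a b^{j_i}.
module Submission where

open import Defs
open import Data.Nat using (ℕ; zero; suc; _+_)
open import Data.Nat.Properties using (+-assoc; +-identityʳ)
open import Data.List using (List; []; _∷_; _++_; map; concatMap; replicate; take; drop; length)
open import Data.List.Properties
  using (++-assoc; ++-identityʳ; ∷-injectiveʳ; map-∘; length-replicate)
open import Data.Product using (_×_; _,_; ∃-syntax)
open import Function using (_∘_)
open import Relation.Binary.PropositionalEquality
  using (_≡_; refl; sym; trans; cong; cong₂; module ≡-Reasoning)
open import Data.List.Relation.Binary.Permutation.Propositional using (_↭_; ↭-reflexive)

open ≡-Reasoning

scale : ℕ × Word → Poly → Poly
scale (e , w) = map (λ (f , v) → (e + f , w ++ v))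

·-identityˡ : ∀ q → one · q ≡ q
·-identityˡ [] = refl
·-identityˡ (s ∷ q) = cong (s ∷_) (·-identityˡ q)

·-identityʳ : ∀ p → p · one ≡ p
·-identityʳ [] = refl
·-identityʳ ((e , w) ∷ p) =
  cong₂ _∷_ (cong₂ _,_ (+-identityʳ e) (++-identityʳ w)) (·-identityʳ p)

·-distribʳ-++ : ∀ p₁ p₂ r → (p₁ ++ p₂) · r ≡ p₁ · r ++ p₂ · r
·-distribʳ-++ [] p₂ r = refl
·-distribʳ-++ (t ∷ p₁) p₂ r =
  trans (cong (scale t r ++_) (·-distribʳ-++ p₁ p₂ r)) (sym (++-assoc (scale t r) (p₁ · r) (p₂ · r)))

scale-++ : ∀ t q₁ q₂ → scale t (q₁ ++ q₂) ≡ scale t q₁ ++ scale t q₂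
scale-++ t [] q₂ = refl
scale-++ t (s ∷ q₁) q₂ = cong (_ ∷_) (scale-++ t q₁ q₂)

scale-scale : ∀ e w f v r → scale (e + f , w ++ v) r ≡ scale (e , w) (scale (f , v) r)
scale-scale e w f v [] = refl
scale-scale e w f v ((g , x) ∷ r) =
  cong₂ _∷_ (cong₂ _,_ (+-assoc e f g) (++-assoc w v x)) (scale-scale e w f v r)

scale-· : ∀ t q r → scale t q · r ≡ scale t (q · r)
scale-· t [] r = refl
scale-· t@(e , w) ((f , v) ∷ q) r = begin
  scale (e + f , w ++ v) r ++ scale t q · r    ≡⟨ cong₂ _++_ (scale-scale e w f v r) (scale-· t q r) ⟩
  scale t (scale (f , v) r) ++ scale t (q · r) ≡⟨ sym (scale-++ t (scale (f , v) r) (q · r)) ⟩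
  scale t (scale (f , v) r ++ q · r)           ∎

·-assoc : ∀ p q r → (p · q) · r ≡ p · (q · r)
·-assoc [] q r = refl
·-assoc (t ∷ p) q r = begin
  (scale t q ++ p · q) · r       ≡⟨ ·-distribʳ-++ (scale t q) (p · q) r ⟩
  scale t q · r ++ (p · q) · r   ≡⟨ cong₂ _++_ (scale-· t q r) (·-assoc p q r) ⟩
  scale t (q · r) ++ p · (q · r) ∎

prepend : ∀ p r s {q} → q ≡ r · s → p · q ≡ (p · r) · s
prepend p r s q≡r·s = trans (cong (p ·_) q≡r·s) (sym (·-assoc p r s))

ω𝐚 ω𝐛 ω𝐚𝐛 : Poly
ω𝐚 = (0 , 𝐚 ∷ []) ∷ (1 , 𝐛 ∷ []) ∷ []
ω𝐛 = (0 , 𝐛 ∷ []) ∷ (1 , 𝐚 ∷ []) ∷ []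
ω𝐚𝐛 = (0 , 𝐚 ∷ 𝐛 ∷ []) ∷ (1 , 𝐛 ∷ 𝐚 ∷ []) ∷ (1 , 𝐚 ∷ 𝐛 ∷ []) ∷ (2 , 𝐛 ∷ 𝐚 ∷ []) ∷ []

ω-++-𝐚 : ∀ w v → ω (w ++ 𝐚 ∷ v) ≡ ω w · ω (𝐚 ∷ v)
ω-++-𝐚 [] v = sym (·-identityˡ (ω (𝐚 ∷ v)))
ω-++-𝐚 (𝐚 ∷ []) v = cong (_· ω (𝐚 ∷ v)) (sym (·-identityʳ ω𝐚))
ω-++-𝐚 (𝐚 ∷ 𝐚 ∷ w) v = prepend ω𝐚 (ω (𝐚 ∷ w)) (ω (𝐚 ∷ v)) (ω-++-𝐚 (𝐚 ∷ w) v)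
ω-++-𝐚 (𝐚 ∷ 𝐛 ∷ w) v = prepend ω𝐚𝐛 (ω w) (ω (𝐚 ∷ v)) (ω-++-𝐚 w v)
ω-++-𝐚 (𝐛 ∷ w) v = prepend ω𝐛 (ω w) (ω (𝐚 ∷ v)) (ω-++-𝐚 w v)

ω-concatMap-block : ∀ js → ω (concatMap block js) ≡ prodP (map (ω ∘ block) js)
ω-concatMap-block [] = refl
ω-concatMap-block (j ∷ []) = begin
  ω (block j ++ []) ≡⟨ cong ω (++-identityʳ (block j)) ⟩
  ω (block j)       ≡⟨ sym (·-identityʳ (ω (block j))) ⟩
  ω (block j) · one ∎
ω-concatMap-block (j ∷ js@(_ ∷ _)) =
  trans (ω-++-𝐚 (block j) _) (cong (ω (block j) ·_) (ω-concatMap-block js))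

take-length-++ : ∀ {A : Set} (xs ys : List A) → take (length xs) (xs ++ ys) ≡ xs
take-length-++ [] ys = refl
take-length-++ (x ∷ xs) ys = cong (x ∷_) (take-length-++ xs ys)

drop-length-++ : ∀ {A : Set} (xs ys : List A) → drop (length xs) (xs ++ ys) ≡ ys
drop-length-++ [] ys = refl
drop-length-++ (x ∷ xs) ys = drop-length-++ xs ys

uFrom-take : ∀ k p ls → uFrom p (take k ls) ≡ take k (uFrom p ls)
uFrom-take zero p ls = refl
uFrom-take (suc k) p [] = refl
uFrom-take (suc k) p (l ∷ ls) = cong (_ ∷_) (uFrom-take k l ls)

uFrom-drop : ∀ k p ls → ∃[ q ] uFrom q (drop k ls) ≡ drop k (uFrom p ls)
uFrom-drop zero p ls = p , refl
uFrom-drop (suc k) p [] = p , refl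
uFrom-drop (suc k) p (l ∷ ls) = uFrom-drop k l ls

uFrom≡blocks⇒uWord≡blocks : ∀ p ls js →
  uFrom p ls ≡ concatMap block js → uWord ls ≡ concatMap block js
uFrom≡blocks⇒uWord≡blocks p [] js eq = eq
uFrom≡blocks⇒uWord≡blocks p (l ∷ ls) (j ∷ js) eq = cong (𝐚 ∷_) (∷-injectiveʳ eq)

module _ (P : FinPoset) (lab : FinPoset.Labeling P) where
  open FinPoset P

  labelsFrom-take : ∀ k x xs → labelsFrom lab x (take k xs) ≡ take k (labelsFrom lab x xs)
  labelsFrom-take zero x xs = refl
  labelsFrom-take (suc k) x [] = refl
  labelsFrom-take (suc k) x (y ∷ xs) = cong (_ ∷_) (labelsFrom-take k y xs)

  labelsFrom-drop : ∀ k x xs →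
    labelsFrom lab (lastFrom x (take k xs)) (drop k xs) ≡ drop k (labelsFrom lab x xs)
  labelsFrom-drop zero x xs = refl
  labelsFrom-drop (suc k) x [] = refl
  labelsFrom-drop (suc k) x (y ∷ xs) = labelsFrom-drop k y xs

  u-segments : ∀ js M →
    u lab M ≡ concatMap block js → map (u lab) (segments js M) ≡ map block js
  u-segments [] _ _ = refl
  u-segments (j ∷ js) (x , y ∷ ys) eq =
    cong₂ _∷_ (cong (𝐚 ∷_) u-head) (u-segments js (lastFrom y (take j ys) , drop j ys) u-rest)
    where
    bs rest : Word
    bs = replicate j 𝐛
    rest = concatMap block js
    ls : List ℕ
    ls = labelsFrom lab y ys
    tail-eq : uFrom (lab x y) ls ≡ bs ++ rest
    tail-eq = ∷-injectiveʳ eq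
    j≡|bs| : j ≡ length bs
    j≡|bs| = sym (length-replicate j)

    u-head : uFrom (lab x y) (labelsFrom lab y (take j ys)) ≡ bs
    u-head = begin
      uFrom (lab x y) (labelsFrom lab y (take j ys)) ≡⟨ cong (uFrom (lab x y)) (labelsFrom-take j y ys) ⟩
      uFrom (lab x y) (take j ls)                    ≡⟨ uFrom-take j (lab x y) ls ⟩
      take j (uFrom (lab x y) ls)                    ≡⟨ cong₂ take j≡|bs| tail-eq ⟩
      take (length bs) (bs ++ rest)                  ≡⟨ take-length-++ bs rest ⟩
      bs                                             ∎

    u-rest : uWord (labelsFrom lab (lastFrom y (take j ys)) (drop j ys)) ≡ rest
    u-rest with uFrom-drop j (lab x y) ls
    ... | q , uFrom-q = uFrom≡blocks⇒uWord≡blocks q _ js (begin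
      uFrom q (labelsFrom lab (lastFrom y (take j ys)) (drop j ys)) ≡⟨ cong (uFrom q) (labelsFrom-drop j y ys) ⟩
      uFrom q (drop j ls)                                           ≡⟨ uFrom-q ⟩
      drop j (uFrom (lab x y) ls)                                   ≡⟨ cong₂ drop j≡|bs| tail-eq ⟩
      drop (length bs) (bs ++ rest)                                 ≡⟨ drop-length-++ bs rest ⟩
      rest                                                          ∎)

lemma4p2 : (P : FinPoset) (n : ℕ) (G : Graded P n) (lab : FinPoset.Labeling P) →
    FinPoset.IsRLabeling P lab →
    (M : FinPoset.Chain P) → FinPoset.IsMaxChain P (Graded.bot G) (Graded.top G) M →
    (js : List ℕ) → FinPoset.u P lab M ≡ concatMap block js →
    ω (FinPoset.u P lab M) ↭ prodP (map (λ S → ω (FinPoset.u P lab S)) (FinPoset.segments P js M))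
lemma4p2 P _ _ lab _ M _ js u≡blocks = ↭-reflexive (begin
  ω (u lab M)                                 ≡⟨ cong ω u≡blocks ⟩
  ω (concatMap block js)                      ≡⟨ ω-concatMap-block js ⟩
  prodP (map (ω ∘ block) js)                  ≡⟨ cong prodP (map-∘ js) ⟩
  prodP (map ω (map block js))                ≡⟨ cong (prodP ∘ map ω) (sym (u-segments P lab js M u≡blocks)) ⟩
  prodP (map ω (map (u lab) (segments js M))) ≡⟨ cong prodP (sym (map-∘ (segments js M))) ⟩
  prodP (map (ω ∘ u lab) (segments js M))     ∎)
  where open FinPoset P
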